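{- Let $n\ge 3$ and let $C$ be a Hamiltonian cycle of the hypercube $Q_n$ (or of a spanning subgraph of $Q_n$). Fix a dimension $i\in\{0,\dots,n-1\}$ and let $e_1,\dots,e_s$ be all the crossing edges of dimension $i$ that belong to $C$. Then $s$ is even, $s>0$, and exactly half of $e_1,\dots,e_s$ are even crossing edges and the other half are odd crossing edges.
   Context: $Q_n$ has vertex set the binary strings $b_{n-1}\dots b_0$ (identified with integers $0,\dots,2^n-1$); two vertices are adjacent iff they differ in exactly one bit, and the edge $(x,x^{(i)})$, where $x^{(i)}$ is $x$ with bit $i$ negated, is said to go along dimension $i$. The parity of a vertex is the parity of the number of ones in its label. The $i$-partition of $Q_n$ splits it into $Q^L=\{x: x_i=0\}$ and $Q^R=\{x: x_i=1\}$; the edges of dimension $i$ (joining $Q^L$ and $Q^R$) are called crossing edges. A crossing edge $(u,u^{(i)})$ with $u\in Q^L$ is even if $u$ has parity 0 and odd if $u$ has parity 1. -}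

module Defs where

open import Data.Nat using (ℕ; zero; suc; _+_; _%_; _≡ᵇ_; _^_)
open import Data.Nat.DivMod using (m%n<n)
open import Data.Bool using (Bool; true; false; if_then_else_; _xor_; _∧_; not)
open import Data.Fin using (Fin; toℕ; fromℕ<)
import Data.Fin as Fin
open import Data.Vec using (Vec; lookup; []; _∷_)
open import Data.Product using (Σ; ∃; _×_)
open import Relation.Binary.PropositionalEquality using (_≡_; _≢_)

-- Vertices of Q_n: bit strings of length n; position i of the vector is bit b_i.
Vertex : ℕ → Set
Vertex n = Vec Bool n

Adjacent : ∀ {n} → Vertex n → Vertex n → Set
Adjacent {n} x y = Σ (Fin n) λ i →
  (lookup x i ≢ lookup y i) × (∀ j → j ≢ i → lookup x j ≡ lookup y j)

ones : ∀ {n} → Vertex n → ℕ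
ones [] = 0
ones (true ∷ xs) = suc (ones xs)
ones (false ∷ xs) = ones xs

parity : ∀ {n} → Vertex n → ℕ
parity x = ones x % 2

next : ∀ {N} → Fin N → Fin N
next {suc m} k = fromℕ< (m%n<n (suc (toℕ k)) (suc m))

IsHamiltonianCycle : (n : ℕ) → (Fin (2 ^ n) → Vertex n) → Set
IsHamiltonianCycle n c =
  (∀ k l → c k ≡ c l → k ≡ l) ×
  (∀ v → ∃ λ k → c k ≡ v) ×
  (∀ k → Adjacent (c k) (c (next k)))

countF : ∀ {N} → (Fin N → Bool) → ℕ
countF {zero} p = 0
countF {suc N} p = (if p Fin.zero then 1 else 0) + countF {N} (λ k → p (Fin.suc k))

crossing : ∀ {n N} → Fin n → (Fin N → Vertex n) → Fin N → Bool
crossing i c k = lookup (c k) i xor lookup (c (next k)) i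

-- endpoint u ∈ Q^L (bit i = 0) of a crossing edge (x , y)
leftEnd : ∀ {n} → Fin n → Vertex n → Vertex n → Vertex n
leftEnd i x y = if lookup x i then y else x

evenCrossing : ∀ {n N} → Fin n → (Fin N → Vertex n) → Fin N → Bool
evenCrossing i c k = crossing i c k ∧ (parity (leftEnd i (c k) (c (next k))) ≡ᵇ 0)

oddCrossing : ∀ {n N} → Fin n → (Fin N → Vertex n) → Fin N → Bool
oddCrossing i c k = crossing i c k ∧ (parity (leftEnd i (c k) (c (next k))) ≡ᵇ 1)

-- Weight the vertices by w = +1 on the even and w = −1 on the odd vertices of Q^L, and by
-- w = 0 on Q^R.  For an edge (x , y) of the cycle, [even crossing] − [odd crossing] equals
-- w x + w y: an edge inside Q^L joins vertices of opposite parity, so its weights cancel.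
-- Summing over all edges counts every vertex twice, so #even − #odd = 2 Σ_v w v, and this
-- vanishes because flipping a bit j ≠ i is an involution of Q^L exchanging the parities.
-- At least one crossing exists because the cycle visits both halves of the i-partition.
module Submission where

open import Defs
open import Data.Nat using (ℕ; _≤_; _<_; _*_; _^_)
open import Data.Nat.Divisibility using (_∣_)
open import Data.Fin using (Fin)
open import Data.Product using (_×_)
open import Relation.Binary.PropositionalEquality using (_≡_)

open import Data.Nat using (zero; suc; _+_; _%_; _≡ᵇ_; s≤s)
open import Data.Nat.Properties using (+-0-commutativeMonoid; +-comm; +-identityʳ; +-cancelʳ-≡; n≢0⇒n>0)
open import Data.Nat.DivMod using (m<n⇒m%n≡m; n%n≡0)
open import Data.Nat.Divisibility using (m∣m*n)
open import Data.Bool using (Bool; true; false; if_then_else_; _xor_; _∧_; not)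
open import Data.Bool.Properties using (not-involutive; not-¬; ¬-not; not-distribˡ-xor; not-distribʳ-xor)
open import Data.Fin using (toℕ; fromℕ; inject₁; _≟_)
open import Data.Fin.Properties using (toℕ-injective; toℕ-fromℕ<; toℕ-fromℕ; toℕ-inject₁; toℕ<n; punchInᵢ≢i)
open import Data.Fin.Induction using (<-weakInduction)
import Data.Fin.Permutation as Permutation
open import Data.Vec using (Vec; lookup; updateAt; replicate; []; _∷_)
open import Data.Vec.Properties using (lookup∘updateAt; lookup∘updateAt′; updateAt-updateAt; updateAt-cong; updateAt-id; tabulate∘lookup; tabulate-cong)
open import Data.Product using (∃; _,_; proj₁; proj₂)
open import Relation.Binary.PropositionalEquality using (_≢_; refl; sym; trans; cong; cong₂; subst; module ≡-Reasoning)
open import Relation.Nullary using (yes; no)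
open import Function using (_∘_)
open import Algebra.Properties.CommutativeMonoid.Sum +-0-commutativeMonoid
  using (sum; sum-cong-≗; ∑-distrib-+; sum-init-last; sum-permute)

iverson : Bool → ℕ
iverson b = if b then 1 else 0

countF≡sum : ∀ {N} (p : Fin N → Bool) → countF p ≡ sum (iverson ∘ p)
countF≡sum {zero} p = refl
countF≡sum {suc N} p = cong (iverson (p Fin.zero) +_) (countF≡sum (p ∘ Fin.suc))

next-inject₁ : ∀ {M} (j : Fin M) → next (inject₁ j) ≡ Fin.suc j
next-inject₁ {M} j = toℕ-injective (begin
  toℕ (next (inject₁ j))      ≡⟨ toℕ-fromℕ< _ ⟩
  suc (toℕ (inject₁ j)) % suc M ≡⟨ cong (λ t → suc t % suc M) (toℕ-inject₁ j) ⟩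
  suc (toℕ j) % suc M         ≡⟨ m<n⇒m%n≡m (s≤s (toℕ<n j)) ⟩
  suc (toℕ j)                 ∎)
  where open ≡-Reasoning

next-fromℕ : ∀ M → next (fromℕ M) ≡ Fin.zero
next-fromℕ M = toℕ-injective (begin
  toℕ (next (fromℕ M))      ≡⟨ toℕ-fromℕ< _ ⟩
  suc (toℕ (fromℕ M)) % suc M ≡⟨ cong (λ t → suc t % suc M) (toℕ-fromℕ M) ⟩
  suc M % suc M             ≡⟨ n%n≡0 (suc M) ⟩
  0                         ∎)
  where open ≡-Reasoning

sum-rotate : ∀ {M} (f : Fin (suc M) → ℕ) → sum (f ∘ next) ≡ sum f
sum-rotate {M} f = begin
  sum (f ∘ next)                              ≡⟨ sum-init-last (f ∘ next) ⟩
  sum (f ∘ next ∘ inject₁) + f (next (fromℕ M)) ≡⟨ cong₂ _+_ (sum-cong-≗ (cong f ∘ next-inject₁)) (cong f (next-fromℕ M)) ⟩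
  sum (f ∘ Fin.suc) + f Fin.zero              ≡⟨ +-comm _ (f Fin.zero) ⟩
  sum f                                       ∎
  where open ≡-Reasoning

next-invariant⇒constant : ∀ {M} {A : Set} (f : Fin (suc M) → A) →
  (∀ k → f (next k) ≡ f k) → ∀ k → f k ≡ f Fin.zero
next-invariant⇒constant f inv = <-weakInduction (λ k → f k ≡ f Fin.zero) refl
  λ j fj≡f0 → trans (cong f (sym (next-inject₁ j))) (trans (inv (inject₁ j)) fj≡f0)

sum-reindex-involution : ∀ {N} {A : Set} (c : Fin N → A) →
  (∀ k l → c k ≡ c l → k ≡ l) → (∀ v → ∃ λ k → c k ≡ v) →
  (σ : A → A) → (∀ v → σ (σ v) ≡ v) → (g : A → ℕ) → sum (g ∘ σ ∘ c) ≡ sum (g ∘ c)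
sum-reindex-involution c inj surj σ σσ g = sym (begin
  sum (g ∘ c)     ≡⟨ sum-permute (g ∘ c) π ⟩
  sum (g ∘ c ∘ τ) ≡⟨ sum-cong-≗ (cong g ∘ c∘τ) ⟩
  sum (g ∘ σ ∘ c) ∎)
  where
  open ≡-Reasoning
  τ : Fin _ → Fin _
  τ k = proj₁ (surj (σ (c k)))
  c∘τ : ∀ k → c (τ k) ≡ σ (c k)
  c∘τ k = proj₂ (surj (σ (c k)))
  τ∘τ : ∀ k → τ (τ k) ≡ k
  τ∘τ k = inj _ _ (trans (c∘τ (τ k)) (trans (cong σ (c∘τ k)) (σσ (c k))))
  π : Permutation.Permutation _ _
  π = Permutation.permutation τ τ τ∘τ τ∘τ

odd : ∀ {n} → Vertex n → Bool
odd [] = false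
odd (b ∷ v) = b xor odd v

%2-suc : ∀ m b → m % 2 ≡ iverson b → suc m % 2 ≡ iverson (not b)
%2-suc zero false _ = refl
%2-suc (suc zero) true _ = refl
%2-suc (suc (suc m)) b m%2 = %2-suc m b m%2

parity≡iverson-odd : ∀ {n} (v : Vertex n) → parity v ≡ iverson (odd v)
parity≡iverson-odd [] = refl
parity≡iverson-odd (true ∷ v) = %2-suc (ones v) (odd v) (parity≡iverson-odd v)
parity≡iverson-odd (false ∷ v) = parity≡iverson-odd v

flip : ∀ {n} → Fin n → Vertex n → Vertex n
flip j v = updateAt v j not

flip-involutive : ∀ {n} (j : Fin n) (v : Vertex n) → flip j (flip j v) ≡ v
flip-involutive j v = trans (updateAt-updateAt j v) (trans (updateAt-cong j not-involutive v) (updateAt-id j v))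

odd-flip : ∀ {n} (j : Fin n) (v : Vertex n) → odd (flip j v) ≡ not (odd v)
odd-flip Fin.zero (b ∷ v) = sym (not-distribˡ-xor b (odd v))
odd-flip (Fin.suc j) (b ∷ v) = trans (cong (b xor_) (odd-flip j v)) (sym (not-distribʳ-xor b (odd v)))

lookup-ext : ∀ {n} {A : Set} (x y : Vec A n) → (∀ j → lookup x j ≡ lookup y j) → x ≡ y
lookup-ext x y eq = trans (sym (tabulate∘lookup x)) (trans (tabulate-cong eq) (tabulate∘lookup y))

adjacent⇒flip : ∀ {n} {x y : Vertex n} → ((i , _ , _) : Adjacent x y) → y ≡ flip i x
adjacent⇒flip {x = x} {y} (i , xᵢ≢yᵢ , agree) = lookup-ext y (flip i x) lookup-y
  where
  lookup-y : ∀ j → lookup y j ≡ lookup (flip i x) j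
  lookup-y j with j ≟ i
  ... | yes refl = trans (¬-not (xᵢ≢yᵢ ∘ sym)) (sym (lookup∘updateAt i x))
  ... | no j≢i = trans (sym (agree j j≢i)) (sym (lookup∘updateAt′ j i j≢i x))

adjacent⇒odd-not : ∀ {n} {x y : Vertex n} → Adjacent x y → odd y ≡ not (odd x)
adjacent⇒odd-not {x = x} {y} adj@(i , _) = trans (cong odd (adjacent⇒flip {x = x} {y} adj)) (odd-flip i x)

module _ {n : ℕ} (i : Fin n) where

  leftEven leftOdd : Vertex n → Bool
  leftEven v = not (lookup v i) ∧ not (odd v)
  leftOdd v = not (lookup v i) ∧ odd v

  evenEdge oddEdge : Vertex n → Vertex n → Bool
  evenEdge x y = (lookup x i xor lookup y i) ∧ (parity (leftEnd i x y) ≡ᵇ 0)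
  oddEdge x y = (lookup x i xor lookup y i) ∧ (parity (leftEnd i x y) ≡ᵇ 1)

  parity-leftEnd : ∀ x y → parity (leftEnd i x y) ≡ iverson (if lookup x i then odd y else odd x)
  parity-leftEnd x y with lookup x i
  ... | true = parity≡iverson-odd y
  ... | false = parity≡iverson-odd x

  crossing-split : ∀ x y → iverson (lookup x i xor lookup y i) ≡ iverson (evenEdge x y) + iverson (oddEdge x y)
  crossing-split x y rewrite parity-leftEnd x y
    with lookup x i xor lookup y i | if lookup x i then odd y else odd x
  ... | true | true = refl
  ... | true | false = refl
  ... | false | _ = refl

  -- evenEdge − oddEdge = w x + w y  for w = leftEven − leftOdd, with the negative terms
  -- moved across so that it lives in ℕ.
  edge-balance : ∀ x y → Adjacent x y →
    iverson (evenEdge x y) + iverson (leftOdd x) + iverson (leftOdd y) ≡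
    iverson (oddEdge x y) + iverson (leftEven x) + iverson (leftEven y)
  edge-balance x y adj rewrite parity-leftEnd x y
    with lookup x i | lookup y i | odd x | odd y | adjacent⇒odd-not {x = x} {y} adj
  ... | a | b | p | _ | refl = balance a b p
    where
    balance : ∀ a b p →
      iverson ((a xor b) ∧ (iverson (if a then not p else p) ≡ᵇ 0)) + iverson (not a ∧ p) + iverson (not b ∧ not p) ≡
      iverson ((a xor b) ∧ (iverson (if a then not p else p) ≡ᵇ 1)) + iverson (not a ∧ not p) + iverson (not b ∧ not (not p))
    balance true  true  true  = refl
    balance true  true  false = refl
    balance true  false true  = refl
    balance true  false false = refl
    balance false true  true  = refl
    balance false true  false = refl
    balance false false true  = refl
    balance false false false = refl

  leftEven-flip : ∀ {j} → j ≢ i → ∀ v → leftEven (flip j v) ≡ leftOdd v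
  leftEven-flip {j} j≢i v =
    cong₂ (λ b p → not b ∧ p) (lookup∘updateAt′ i j (j≢i ∘ sym) v)
      (trans (cong not (odd-flip j v)) (not-involutive (odd v)))

countF≡0⇒false : ∀ {N} (p : Fin N → Bool) → countF p ≡ 0 → ∀ k → p k ≡ false
countF≡0⇒false {suc N} p none k with p Fin.zero in p₀
countF≡0⇒false {suc N} p none Fin.zero | false = p₀
countF≡0⇒false {suc N} p none (Fin.suc k) | false = countF≡0⇒false (p ∘ Fin.suc) none k

crossings≡even+odd : ∀ {n N} (i : Fin n) (c : Fin N → Vertex n) →
  countF (crossing i c) ≡ countF (evenCrossing i c) + countF (oddCrossing i c)
crossings≡even+odd i c = begin
  countF (crossing i c)                                    ≡⟨ countF≡sum (crossing i c) ⟩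
  sum (iverson ∘ crossing i c)                             ≡⟨ sum-cong-≗ (λ k → crossing-split i (c k) (c (next k))) ⟩
  sum (λ k → iverson (evenCrossing i c k) + iverson (oddCrossing i c k)) ≡⟨ ∑-distrib-+ (iverson ∘ evenCrossing i c) (iverson ∘ oddCrossing i c) ⟩
  sum (iverson ∘ evenCrossing i c) + sum (iverson ∘ oddCrossing i c)
    ≡⟨ sym (cong₂ _+_ (countF≡sum (evenCrossing i c)) (countF≡sum (oddCrossing i c))) ⟩
  countF (evenCrossing i c) + countF (oddCrossing i c)     ∎
  where open ≡-Reasoning

crossings-positive : ∀ {n N} (i : Fin n) (c : Fin N → Vertex n) →
  (∀ v → ∃ λ k → c k ≡ v) → 0 < countF (crossing i c)
crossings-positive {N = zero} i c surj with () ← proj₁ (surj (replicate _ false))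
crossings-positive {N = suc M} i c surj = n≢0⇒n>0 λ none →
  let (k , cₖ≡) = surj (flip i (c Fin.zero))
  in not-¬ refl (begin
    bit Fin.zero                      ≡⟨ bit-constant none k ⟨
    bit k                             ≡⟨ cong (λ v → lookup v i) cₖ≡ ⟩
    lookup (flip i (c Fin.zero)) i    ≡⟨ lookup∘updateAt i (c Fin.zero) ⟩
    not (bit Fin.zero)                ∎)
  where
  open ≡-Reasoning
  bit : Fin _ → Bool
  bit k = lookup (c k) i
  bit-constant : countF (crossing i c) ≡ 0 → ∀ k → bit k ≡ bit Fin.zero
  bit-constant none = next-invariant⇒constant bit λ k →
    unchanged (bit k) (bit (next k)) (countF≡0⇒false (crossing i c) none k)
    where
    unchanged : ∀ a b → a xor b ≡ false → b ≡ a
    unchanged true true _ = refl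
    unchanged false false _ = refl

sum-along-cycle : ∀ {M} (e w : Fin (suc M) → ℕ) →
  sum (λ k → e k + w k + w (next k)) ≡ sum e + sum w + sum w
sum-along-cycle e w = trans (∑-distrib-+ (λ k → e k + w k) (w ∘ next)) (cong₂ _+_ (∑-distrib-+ e w) (sum-rotate w))

evenCrossings≡oddCrossings : ∀ {n N} (c : Fin N → Vertex n) →
  (∀ k l → c k ≡ c l → k ≡ l) → (∀ v → ∃ λ k → c k ≡ v) → (∀ k → Adjacent (c k) (c (next k))) →
  ∀ {i j : Fin n} → j ≢ i → countF (evenCrossing i c) ≡ countF (oddCrossing i c)
evenCrossings≡oddCrossings {N = zero} c _ _ _ _ = refl
evenCrossings≡oddCrossings {N = suc M} c inj surj adj {i} {j} j≢i =
  +-cancelʳ-≡ Lo E O (+-cancelʳ-≡ Lo (E + Lo) (O + Lo) (begin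
    E + Lo + Lo               ≡⟨ cong (λ t → t + Lo + Lo) (countF≡sum (evenCrossing i c)) ⟩
    sum e + Lo + Lo           ≡⟨ sum-along-cycle e lo ⟨
    sum (λ k → e k + lo k + lo (next k)) ≡⟨ sum-cong-≗ (λ k → edge-balance i (c k) (c (next k)) (adj k)) ⟩
    sum (λ k → o k + le k + le (next k)) ≡⟨ sum-along-cycle o le ⟩
    sum o + Le + Le           ≡⟨ cong₂ (λ s t → s + t + t) (countF≡sum (oddCrossing i c)) (sym Le≡Lo) ⟨
    O + Lo + Lo               ∎))
  where
  open ≡-Reasoning
  e o le lo : Fin _ → ℕ
  e = iverson ∘ evenCrossing i c
  o = iverson ∘ oddCrossing i c
  le = iverson ∘ leftEven i ∘ c
  lo = iverson ∘ leftOdd i ∘ c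
  E O Le Lo : ℕ
  E = countF (evenCrossing i c)
  O = countF (oddCrossing i c)
  Le = sum le
  Lo = sum lo
  Le≡Lo : Le ≡ Lo
  Le≡Lo = trans (sym (sum-reindex-involution c inj surj (flip j) (flip-involutive j) (iverson ∘ leftEven i)))
                (sum-cong-≗ (cong iverson ∘ leftEven-flip i j≢i ∘ c))

lemma3 : (n : ℕ) → 3 ≤ n → (c : Fin (2 ^ n) → Vertex n) → IsHamiltonianCycle n c →
    (i : Fin n) →
    (2 ∣ countF (crossing i c)) × (0 < countF (crossing i c)) ×
    (2 * countF (evenCrossing i c) ≡ countF (crossing i c)) ×
    (2 * countF (oddCrossing i c) ≡ countF (crossing i c))
lemma3 _ (s≤s (s≤s _)) c (inj , surj , adj) i =
  subst (2 ∣_) 2E≡C (m∣m*n E) , crossings-positive i c surj , 2E≡C , trans (cong (2 *_) (sym E≡O)) 2E≡C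
  where
  E : ℕ
  E = countF (evenCrossing i c)
  E≡O : E ≡ countF (oddCrossing i c)
  E≡O = evenCrossings≡oddCrossings c inj surj adj (punchInᵢ≢i i Fin.zero)
  2E≡C : 2 * E ≡ countF (crossing i c)
  2E≡C = trans (cong (E +_) (trans (+-identityʳ E) E≡O)) (sym (crossings≡even+odd i c))
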